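{- Let $\mathcal{T}$ be a first-order theory, $\varphi_{\mathcal{T}}(\overline{x},\overline{y})$ an $\mathrm{LTL}_{\mathcal{T}}$ specification with literals $l_1,\dots,l_n$, $\varphi_{\mathbb{B}}$ its Boolean abstraction, and $C_{\mathbb{B}}=\langle Q,q_0,\delta,o\rangle$ a winning controller for $\varphi_{\mathbb{B}}$. Let $q$ be the state of $C_{\mathbb{B}}$ after processing (the Boolean inputs corresponding to) inputs $v_{\overline{x}}^0,\dots,v_{\overline{x}}^n$, and let $v_{\overline{x}}$ be the next environment input. Let $v_{\overline{e}}$ be the Boolean input computed by the partitioner from $v_{\overline{x}}$, corresponding to the reaction $r$ with $f_r(v_{\overline{x}})$ true, let $v_{\overline{s}}=o(q,v_{\overline{e}})$ and let $c$ be the choice associated to $v_{\overline{s}}$. Then, if $r$ is a valid reaction, $c\in r$ and the formula $\exists\overline{y}.\,\big(f_r(v_{\overline{x}})\rightarrow f_c(\overline{y},v_{\overline{x}})\big)$ is satisfiable in $\mathcal{T}$.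
   Context: $\mathrm{LTL}_{\mathcal{T}}$ is LTL with literals of $\mathcal{T}$ as atoms; environment controls $\overline{x}$, system controls $\overline{y}$. A Boolean controller $\langle Q,q_0,\delta,o\rangle$ over environment propositions $\overline{e}$ and system propositions $\overline{s}$ has $Q$ finite, $\delta:Q\times\mathrm{val}(\overline{e})\to Q$, $o:Q\times\mathrm{val}(\overline{e})\to\mathrm{val}(\overline{s})$; it is winning if all its plays satisfy the formula. Boolean abstraction: fresh system propositions $s_i$ for $l_i$; a choice $c\subseteq\{s_1,\dots,s_n\}$ is identified with the valuation of $\overline{s}$ making exactly $s_i\in c$ true, and $f_c(\overline{x},\overline{y})=\bigwedge_{s_i\in c}l_i\wedge\bigwedge_{s_i\notin c}\neg l_i$. A reaction $r$ is a set of choices with $f_r(\overline{x})=\bigwedge_{c\in r}\exists\overline{y}.f_c\wedge\bigwedge_{c\notin r}\forall\overline{y}.\neg f_c$; it is valid if $\exists\overline{x}.f_r$ is true in $\mathcal{T}$; each valuation of $\overline{x}$ satisfies $f_r$ for exactly one valid $r$. For each valid $r$ a fresh environment proposition $e_r$; the partitioner maps $v_{\overline{x}}$ to the valuation of $\overline{e}$ making only $e_r$ true, where $f_r(v_{\overline{x}})$ holds. $\varphi^{legal}$ says exactly one $e_r$ is true; $\varphi_{\mathbb{B}}=\varphi_{\mathcal{T}}[l_i\leftarrow s_i]\wedge\square(\varphi^{legal}\rightarrow\bigwedge_r(e_r\rightarrow\bigvee_{c\in r}(\bigwedge_{s_i\in c}s_i\wedge\bigwedge_{s_i\notin c}\neg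 s_i)))$. -}

module Defs where

open import Data.Nat using (ℕ; zero; suc; _+_; _<_)
open import Data.Fin using (Fin)
open import Data.Bool using (Bool; true; false; _≟_; _∧_)
open import Data.Vec using (Vec; []; _∷_; lookup)
open import Data.List using (List; []; _∷_; map; _++_; foldl)
open import Data.Unit using (⊤)
open import Data.Product using (Σ; _×_; _,_; proj₁)
open import Data.Sum using (_⊎_; inj₁; inj₂)
open import Data.Empty using (⊥)
open import Relation.Nullary using (¬_; does)
open import Relation.Binary.PropositionalEquality using (_≡_)

-- First-order theory, semantically: a domain X of valuations of x̄,
-- a domain Y of valuations of ȳ and n literals l_i(x̄,ȳ) interpreted
-- as predicates  lit i : X → Y → Set.

-- a choice c ⊆ {s_1..s_n}, as a valuation of s̄
Choice : ℕ → Set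
Choice n = Vec Bool n

Reaction : ℕ → Set
Reaction n = Choice n → Bool

module Theory {X Y : Set} {n : ℕ} (lit : Fin n → X → Y → Set) where

  fC : Choice n → X → Y → Set
  fC c x y = ∀ i → (lookup c i ≡ true → lit i x y) × (lookup c i ≡ false → ¬ lit i x y)

  fR : Reaction n → X → Set
  fR r x = (∀ c → r c ≡ true → Σ Y (λ y → fC c x y))
         × (∀ c → r c ≡ false → ∀ y → ¬ fC c x y)

  Valid : Reaction n → Set
  Valid r = Σ X (λ x → fR r x)

  -- valid reactions index the fresh environment propositions e_r
  ValidR : Set
  ValidR = Σ (Reaction n) Valid

allChoices : (n : ℕ) → List (Choice n)
allChoices zero = [] ∷ []
allChoices (suc n) = map (true ∷_) (allChoices n) ++ map (false ∷_) (allChoices n)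

allB : {A : Set} → (A → Bool) → List A → Bool
allB p [] = true
allB p (a ∷ as) = p a ∧ allB p as

eqR : {n : ℕ} → Reaction n → Reaction n → Bool
eqR {n} r r' = allB (λ c → does (r c ≟ r' c)) (allChoices n)

data LTL (A : Set) : Set where
  tt   : LTL A
  atom : A → LTL A
  ¬'_  : LTL A → LTL A
  _∧'_ : LTL A → LTL A → LTL A
  _∨'_ : LTL A → LTL A → LTL A
  X'_  : LTL A → LTL A
  _U'_ : LTL A → LTL A → LTL A

rename : {A B : Set} → (A → B) → LTL A → LTL B
rename f tt = tt
rename f (atom a) = atom (f a)
rename f (¬' φ) = ¬' rename f φ
rename f (φ ∧' ψ) = rename f φ ∧' rename f ψ
rename f (φ ∨' ψ) = rename f φ ∨' rename f ψ
rename f (X' φ) = X' rename f φ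
rename f (φ U' ψ) = rename f φ U' rename f ψ

Trace : Set → Set
Trace A = ℕ → A → Bool

sat : {A : Set} → Trace A → ℕ → LTL A → Set
sat w t tt = ⊤
sat w t (atom a) = w t a ≡ true
sat w t (¬' φ) = ¬ sat w t φ
sat w t (φ ∧' ψ) = sat w t φ × sat w t ψ
sat w t (φ ∨' ψ) = sat w t φ ⊎ sat w t ψ
sat w t (X' φ) = sat w (suc t) φ
sat w t (φ U' ψ) = Σ ℕ (λ k → sat w (k + t) ψ × (∀ j → j < k → sat w (j + t) φ))

record Controller (E : Set) (n : ℕ) : Set where
  field
    m  : ℕ
    q₀ : Fin m
    δ  : Fin m → (E → Bool) → Fin m
    o  : Fin m → (E → Bool) → (Fin n → Bool)

module _ {E : Set} {n : ℕ} (C : Controller E n) where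
  open Controller C

  state : (ℕ → E → Bool) → ℕ → Fin m
  state ins zero = q₀
  state ins (suc t) = δ (state ins t) (ins t)

  play : (ℕ → E → Bool) → Trace (E ⊎ Fin n)
  play ins t (inj₁ e) = ins t e
  play ins t (inj₂ i) = o (state ins t) (ins t) i

  run : List (E → Bool) → Fin m
  run = foldl δ q₀

module Abstraction {X Y : Set} {n : ℕ} (lit : Fin n → X → Y → Set) where
  open Theory lit public

  Prop : Set
  Prop = ValidR ⊎ Fin n

  onlyE : ValidR → (ValidR → Bool)
  onlyE r r' = eqR (proj₁ r') (proj₁ r)

  Legal : (Prop → Bool) → Set
  Legal v = Σ ValidR (λ r → v (inj₁ r) ≡ true
              × (∀ r' → v (inj₁ r') ≡ true → eqR (proj₁ r') (proj₁ r) ≡ true))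

  -- satisfaction of φ_B = φ_T[l_i ← s_i] ∧ □(φ^legal → ⋀_r (e_r → ⋁_{c∈r} s̄ = c))
  SatB : LTL (Fin n) → Trace Prop → Set
  SatB φT w = sat w 0 (rename inj₂ φT)
    × (∀ t → Legal (w t) → ∀ r → w t (inj₁ r) ≡ true →
         Σ (Choice n) (λ c → proj₁ r c ≡ true × (∀ i → w t (inj₂ i) ≡ lookup c i)))

  Winning : LTL (Fin n) → Controller ValidR n → Set
  Winning φT C = ∀ ins → SatB φT (play C ins)

  -- one step of input as seen by the partitioner: a T-input v_x̄ together
  -- with the (valid) reaction r such that f_r(v_x̄) holds
  record PInput : Set where
    constructor pin
    field
      vx  : X
      r   : ValidR
      fr  : fR (proj₁ r) vx

  partIn : PInput → (ValidR → Bool)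
  partIn p = onlyE (PInput.r p)

-- A winning controller must also answer correctly to every history, not only
-- to those it will actually see.  Feeding it a history followed forever by the
-- partitioner's encoding of r yields a play whose next step is legal and has
-- e_r true; the second conjunct of φ_B then forces the controller's output to
-- be a choice c ∈ r.  Since f_r(v_x̄) holds and c ∈ r, f_r(v_x̄) provides a
-- witness ȳ with f_c(v_x̄, ȳ).
module Submission where

open import Defs
open import Data.Nat using (ℕ; zero; suc)
open import Data.Fin using (Fin)
open import Data.Bool using (Bool; true)
open import Data.Bool.Properties using () renaming (_≟_ to _≟ᵇ_)
open import Data.Vec using (tabulate; lookup)
open import Data.Vec.Properties using (tabulate-cong; tabulate∘lookup)
open import Data.List using (List; []; _∷_; _∷ʳ_; map; length; applyUpTo)
open import Data.List.Properties using (foldl-∷ʳ; applyUpTo-∷ʳ)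
open import Data.Product using (Σ; _×_; _,_; proj₁; proj₂)
open import Data.Sum using (inj₁; inj₂)
open import Relation.Nullary.Decidable using (dec-true)
open import Relation.Binary.PropositionalEquality
  using (_≡_; refl; sym; trans; cong; cong-app; subst; module ≡-Reasoning)

_thenForever_ : {A : Set} → List A → A → ℕ → A
([]     thenForever v) t       = v
((a ∷ as) thenForever v) zero    = a
((a ∷ as) thenForever v) (suc t) = (as thenForever v) t

applyUpTo-thenForever : {A : Set} (as : List A) (v : A) →
  applyUpTo (as thenForever v) (length as) ≡ as
applyUpTo-thenForever []       v = refl
applyUpTo-thenForever (a ∷ as) v = cong (a ∷_) (applyUpTo-thenForever as v)

thenForever-length : {A : Set} (as : List A) (v : A) → (as thenForever v) (length as) ≡ v
thenForever-length []       v = refl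
thenForever-length (a ∷ as) v = thenForever-length as v

module _ {E : Set} {n : ℕ} (C : Controller E n) where
  open Controller C

  state≡run-applyUpTo : ∀ ins t → state C ins t ≡ run C (applyUpTo ins t)
  state≡run-applyUpTo ins zero    = refl
  state≡run-applyUpTo ins (suc t) = begin
    δ (state C ins t) (ins t)           ≡⟨ cong (λ q → δ q (ins t)) (state≡run-applyUpTo ins t) ⟩
    δ (run C (applyUpTo ins t)) (ins t) ≡⟨ sym (foldl-∷ʳ δ q₀ (ins t) (applyUpTo ins t)) ⟩
    run C (applyUpTo ins t ∷ʳ ins t)    ≡⟨ cong (run C) (applyUpTo-∷ʳ ins t) ⟩
    run C (applyUpTo ins (suc t))       ∎
    where open ≡-Reasoning

  state-thenForever : ∀ as v → state C (as thenForever v) (length as) ≡ run C as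
  state-thenForever as v =
    trans (state≡run-applyUpTo (as thenForever v) (length as))
          (cong (run C) (applyUpTo-thenForever as v))

allB-true : {A : Set} (p : A → Bool) → (∀ a → p a ≡ true) → ∀ as → allB p as ≡ true
allB-true p h []       = refl
allB-true p h (a ∷ as) rewrite h a = allB-true p h as

eqR-refl : {n : ℕ} (r : Reaction n) → eqR r r ≡ true
eqR-refl {n} r = allB-true _ (λ c → dec-true (r c ≟ᵇ r c) refl) (allChoices n)

module _ {X Y : Set} {n : ℕ} (lit : Fin n → X → Y → Set) where
  open Abstraction lit

  onlyE-self : ∀ r → onlyE r r ≡ true
  onlyE-self r = eqR-refl (proj₁ r)

  legal-onlyE : ∀ (v : Prop → Bool) r → (λ r' → v (inj₁ r')) ≡ onlyE r → Legal v
  legal-onlyE v r v≡ =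
    r , trans (cong-app v≡ r) (onlyE-self r) , λ r' h → trans (sym (cong-app v≡ r')) h

  winning-output∈reaction : ∀ φT (C : Controller ValidR n) → Winning φT C →
    ∀ (hist : List (ValidR → Bool)) r →
    proj₁ r (tabulate (Controller.o C (run C hist) (onlyE r))) ≡ true
  winning-output∈reaction φT C win hist r =
    subst (λ c → proj₁ r c ≡ true) (sym output≡c) (proj₁ (proj₂ forced))
    where
      open Controller C
      ins = hist thenForever onlyE r
      T = length hist
      ins-T = thenForever-length hist (onlyE r)

      e-r-true : play C ins T (inj₁ r) ≡ true
      e-r-true = trans (cong-app ins-T r) (onlyE-self r)

      forced = proj₂ (win ins) T (legal-onlyE (play C ins T) r ins-T) r e-r-true
      c = proj₁ forced

      output-at-T : ∀ i → o (run C hist) (onlyE r) i ≡ lookup c i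
      output-at-T i = begin
        o (run C hist) (onlyE r) i    ≡⟨ cong (λ q → o q (onlyE r) i) (sym (state-thenForever C hist (onlyE r))) ⟩
        o (state C ins T) (onlyE r) i ≡⟨ cong (λ e → o (state C ins T) e i) (sym ins-T) ⟩
        play C ins T (inj₂ i)         ≡⟨ proj₂ (proj₂ forced) i ⟩
        lookup c i                    ∎
        where open ≡-Reasoning

      output≡c : tabulate (o (run C hist) (onlyE r)) ≡ c
      output≡c = trans (tabulate-cong output-at-T) (tabulate∘lookup c)

lemma1 : {X Y : Set} {n : ℕ} (lit : Fin n → X → Y → Set) (φT : LTL (Fin n))
    (C : Controller (Abstraction.ValidR lit) n) → Abstraction.Winning lit φT C →
    (hist : List (Abstraction.PInput lit)) (vx : X)
    (r : Reaction n) (hv : Abstraction.Valid lit r) → Abstraction.fR lit r vx →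
    let q = run C (map (Abstraction.partIn lit) hist)
        c = tabulate (Controller.o C q (Abstraction.onlyE lit (r , hv)))
    in (r c ≡ true) × Σ Y (λ y → Abstraction.fR lit r vx → Abstraction.fC lit c vx y)
lemma1 lit φT C win hist vx r hv fr = c∈r , proj₁ witness , λ _ → proj₂ witness
  where
    open Abstraction lit
    c∈r = winning-output∈reaction lit φT C win (map partIn hist) (r , hv)
    witness = proj₁ fr _ c∈r
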